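{- Let $n\ge 1$. The map $\pi:\widehat{\mathcal{T}}_n\to\widehat{\mathcal{T}}_n$ defined in the context is a bijection.
   Context: A plane binary tree is a rooted tree in which every vertex is either an endpoint (leaf) or has exactly two children, an ordered left child and right child. $\mathcal{T}_n$ is the set of plane binary trees with $n+2$ endpoints, ordered left to right. A non-root vertex is a left (resp. right) descendent if it is the left (resp. right) child of its parent. A last branching vertex is a non-endpoint vertex both of whose children are endpoints (for $n\ge1$ it is never the root). A marked tree is a pair $(T,v)$ with $T\in\mathcal{T}_n$ and $v$ a last branching vertex of $T$; $\widehat{\mathcal{T}}_n$ is the set of marked trees. Definition of $\pi$: given $(T,v)$, first contract $v$: delete its two endpoint children so that $v$ becomes an endpoint $v'$ (the resulting tree has $n+1$ endpoints, and $v'$ is a left/right descendent exactly as $v$ was). Then choose an endpoint $w$ of the contracted tree, replace $w$ by a vertex with two endpoint children (a last branching vertex), and mark this new vertex; the result is $\pi(T,v)$. The endpoint $w$ is chosen as follows. If $v$ is a right descendent: if $v'$ is not the rightmost endpoint, $w$ is the first endpoint to the right of $v'$ (in left-to-right order) that is a right descendent; if $v'$ is the rightmost endpoint, $w$ is the rightmost endpoint that is a left descendent. If $v$ is a left descendent: if $v'$ is not the leftmost endpoint, $w$ is the first endpoint to the left of $v'$ that is a left descendent; if $v'$ is the leftmost endpoint, $w$ is the leftmost endpoint that is a right descendent. -}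

module Defs where

open import Data.Nat using (ℕ; _+_)
open import Data.Bool using (Bool; true; false; if_then_else_)
open import Data.List using (List; []; _∷_; _++_; map; length; reverse)
open import Data.Maybe using (Maybe; just; nothing)
open import Data.Product using (_×_; _,_)
open import Relation.Nullary using (yes; no)
open import Relation.Binary.PropositionalEquality using (_≡_; refl)
import Data.List.Properties as LP

data Tree : Set where
  leaf : Tree
  node : Tree → Tree → Tree

-- Vertices are addressed by their path from the root.
data Dir : Set where
  L R : Dir

Path : Set
Path = List Dir

_≟D_ : (a b : Dir) → Relation.Nullary.Dec (a ≡ b)
L ≟D L = yes refl
L ≟D R = no (λ ())
R ≟D L = no (λ ())
R ≟D R = yes refl

_≟P_ : (p q : Path) → Relation.Nullary.Dec (p ≡ q)
_≟P_ = LP.≡-dec _≟D_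

leaves : Tree → List Path
leaves leaf = [] ∷ []
leaves (node l r) = map (L ∷_) (leaves l) ++ map (R ∷_) (leaves r)

subtree : Tree → Path → Maybe Tree
subtree t [] = just t
subtree leaf (_ ∷ _) = nothing
subtree (node l r) (L ∷ p) = subtree l p
subtree (node l r) (R ∷ p) = subtree r p

replace : Tree → Path → Tree → Tree
replace t [] s = s
replace leaf (_ ∷ _) s = leaf
replace (node l r) (L ∷ p) s = node (replace l p s) r
replace (node l r) (R ∷ p) s = node l (replace r p s)

-- Last step of a path: just L = left descendent, just R = right
-- descendent, nothing = root.
lastDir : Path → Maybe Dir
lastDir [] = nothing
lastDir (d ∷ []) = just d
lastDir (_ ∷ p ∷ ps) = lastDir (p ∷ ps)

isDesc : Dir → Path → Bool
isDesc d p with lastDir p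
... | nothing = false
... | just e with d ≟D e
...   | yes _ = true
...   | no _ = false

-- A last branching vertex: a vertex both of whose children are endpoints.
IsLBV : Tree → Path → Set
IsLBV t p = subtree t p ≡ just (node leaf leaf)

-- Raw marked pairs (tree, marked vertex); validity is a separate predicate.
Marked : Set
Marked = Tree × Path

-- (T , v) ∈ \hat{T}_n : T has n+2 endpoints and v is a last branching vertex.
ValidMarked : ℕ → Marked → Set
ValidMarked n (t , p) = (length (leaves t) ≡ n + 2) × IsLBV t p

after : Path → List Path → List Path
after p [] = []
after p (q ∷ qs) with p ≟P q
... | yes _ = qs
... | no _ = after p qs

firstSuch : (Path → Bool) → List Path → Maybe Path
firstSuch f [] = nothing
firstSuch f (q ∷ qs) = if f q then just q else firstSuch f qs

isEmpty : List Path → Bool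
isEmpty [] = true
isEmpty (_ ∷ _) = false

-- Choice of the endpoint w in the contracted tree, given the contracted
-- endpoint v' (same path as v) and the endpoints of the contracted tree
-- in left-to-right order.
chooseW : Path → List Path → Maybe Path
chooseW v ls with lastDir v
... | nothing = nothing
... | just R =
  if isEmpty (after v ls)
  then firstSuch (isDesc L) (reverse ls)
  else firstSuch (isDesc R) (after v ls)
... | just L =
  if isEmpty (after v (reverse ls))
  then firstSuch (isDesc R) ls
  else firstSuch (isDesc L) (after v (reverse ls))

-- The map π.  (On invalid raw inputs, where no w exists, it returns the
-- input unchanged; this never happens on \hat{T}_n.)
π : Marked → Marked
π (t , v) with chooseW v (leaves (replace t v leaf))
... | nothing = (t , v)
... | just w = (replace (replace t v leaf) w (node leaf leaf) , w)

-- Contract the marked vertex of (T , v) to an endpoint v′. The resulting tree has n + 1 ≥ 2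
-- endpoints, each a left or a right descendent, and π never changes it: contracting π (T , v)
-- at its mark gives back the same tree. Arrange its endpoints in a cycle, first the right
-- descendents from left to right, then the left descendents from right to left. Every case in
-- the definition of w says that w is the successor of v′ on this cycle (the rightmost endpoint
-- is a right and the leftmost a left descendent, so every search succeeds). Hence π acts on
-- marked trees with a fixed contraction as the successor permutation of a cycle, and the
-- predecessor provides the inverse.
module Submission where

open import Defs

open import Data.Bool using (Bool; true; false; T; if_then_else_)
open import Data.Empty using (⊥; ⊥-elim)
open import Data.List using (List; []; _∷_; _++_; _∷ʳ_; [_]; map; length; reverse; _ʳ++_; head; filterᵇ)
open import Data.List.Membership.Propositional using (_∈_; _∉_)
open import Data.List.Membership.Propositional.Properties
  using (∈-∃++; ∈-insert; ∈-++⁺ˡ; ∈-++⁺ʳ; ∈-++⁻; ∈-map⁺; ∈-map⁻; ∈-filter⁺; ∈-filter⁻)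
open import Data.List.Properties
  using (∷-injective; ∷-injectiveˡ; ∷-injectiveʳ; ++-assoc; reverse-++; ʳ++-defn; unfold-reverse;
         reverse-involutive; filter-++; filter-accept; length-++; length-map; map-++)
open import Data.List.Relation.Unary.All using ([])
open import Data.List.Relation.Unary.AllPairs using ([]; _∷_)
open import Data.List.Relation.Unary.Any using (here; there)
open import Data.List.Relation.Unary.Any.Properties using (reverse⁺; reverse⁻)
open import Data.List.Relation.Unary.Unique.Propositional using (Unique)
open import Data.List.Relation.Unary.Unique.Propositional.Properties
  using (Unique[x∷xs]⇒x∉xs; ++⁺; map⁺; filter⁺)
import Data.List.Relation.Binary.Permutation.Setoid as Permutation
import Data.List.Relation.Binary.Permutation.Setoid.Properties as PermutationProperties
open import Data.Maybe using (just)
open import Data.Nat using (ℕ; suc; _+_; _≤_)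
open import Data.Nat.Properties using (+-assoc; +-comm; +-cancelʳ-≡; +-commutativeSemigroup)
open import Algebra.Properties.CommutativeSemigroup +-commutativeSemigroup using (xy∙z≈xz∙y)
open import Data.Product using (Σ; _×_; _,_; proj₁; proj₂; ∃; ∃₂)
open import Data.Sum using (_⊎_; inj₁; inj₂)
open import Data.Unit using (tt)
open import Function using (_∘_)
open import Relation.Nullary using (¬_; Dec; yes; no)
open import Relation.Nullary.Decidable using (T?)
open import Relation.Binary.PropositionalEquality
  using (_≡_; refl; sym; trans; cong; cong₂; subst; setoid; module ≡-Reasoning)

open ≡-Reasoning

module _ {a} {A : Set a} where

  private
    variable
      x x′ y y′ z : A
      us vs xs ys : List A

  ∈⇒∷ : x ∈ xs → ∃₂ λ y ys → xs ≡ y ∷ ys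
  ∈⇒∷ {xs = y ∷ ys} _ = y , ys , refl

  last-∈-suffix : ∀ us → us ++ y ∷ ys ≡ xs ∷ʳ z → z ∈ y ∷ ys
  last-∈-suffix {xs = xs}     []       eq = subst (_ ∈_) (sym eq) (∈-insert xs)
  last-∈-suffix {xs = _ ∷ xs} (u ∷ us) eq = last-∈-suffix us (∷-injectiveʳ eq)
  last-∈-suffix {xs = []}     (u ∷ []) ()
  last-∈-suffix {xs = []}     (u ∷ _ ∷ _) ()

  reverse-++-∷ : ∀ (us : List A) x vs → reverse (us ++ x ∷ vs) ≡ reverse vs ++ x ∷ reverse us
  reverse-++-∷ us x vs = begin
    reverse (us ++ x ∷ vs)                ≡⟨ reverse-++ us (x ∷ vs) ⟩
    (vs ʳ++ x ∷ []) ++ reverse us         ≡⟨ cong (_++ reverse us) (ʳ++-defn vs) ⟩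
    (reverse vs ++ x ∷ []) ++ reverse us  ≡⟨ ++-assoc (reverse vs) _ (reverse us) ⟩
    reverse vs ++ x ∷ reverse us          ∎

  reverse-++-∷-∷ : ∀ (us : List A) x y vs → reverse (us ++ x ∷ y ∷ vs) ≡ reverse vs ++ y ∷ x ∷ reverse us
  reverse-++-∷-∷ us x y vs = begin
    reverse (us ++ x ∷ y ∷ vs)               ≡⟨ reverse-++ us (x ∷ y ∷ vs) ⟩
    (vs ʳ++ y ∷ x ∷ []) ++ reverse us        ≡⟨ cong (_++ reverse us) (ʳ++-defn vs) ⟩
    (reverse vs ++ y ∷ x ∷ []) ++ reverse us ≡⟨ ++-assoc (reverse vs) _ (reverse us) ⟩
    reverse vs ++ y ∷ x ∷ reverse us         ∎

  filterᵇ-ʳ++ : ∀ (f : A → Bool) xs ys → filterᵇ f (xs ʳ++ ys) ≡ filterᵇ f xs ʳ++ filterᵇ f ys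
  filterᵇ-ʳ++ f []       ys = refl
  filterᵇ-ʳ++ f (x ∷ xs) ys with f x | filterᵇ-ʳ++ f xs (x ∷ ys)
  ... | true  | ih = ih
  ... | false | ih = ih

  filterᵇ-reverse : ∀ (f : A → Bool) xs → filterᵇ f (reverse xs) ≡ reverse (filterᵇ f xs)
  filterᵇ-reverse f xs = filterᵇ-ʳ++ f xs []

  Unique-reverse : Unique xs → Unique (reverse xs)
  Unique-reverse {xs} = PermutationProperties.Unique-resp-↭ (setoid A)
    (Permutation.↭-sym (setoid A) (PermutationProperties.↭-reverse (setoid A) xs))

  Unique-++-∷⇒∉ˡ : ∀ us → Unique (us ++ x ∷ vs) → x ∉ us
  Unique-++-∷⇒∉ˡ (u ∷ us) uq       (here refl) = Unique[x∷xs]⇒x∉xs uq (∈-insert us)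
  Unique-++-∷⇒∉ˡ (u ∷ us) (_ ∷ uq) (there m)   = Unique-++-∷⇒∉ˡ us uq m

  Unique-++-∷⇒∉ʳ : ∀ us → Unique (us ++ x ∷ vs) → x ∉ vs
  Unique-++-∷⇒∉ʳ []       uq       = Unique[x∷xs]⇒x∉xs uq
  Unique-++-∷⇒∉ʳ (u ∷ us) (_ ∷ uq) = Unique-++-∷⇒∉ʳ us uq

  Unique⇒++-∷-injective : ∀ us vs us′ vs′ → Unique (us ++ x ∷ vs) →
                          us ++ x ∷ vs ≡ us′ ++ x ∷ vs′ → us ≡ us′ × vs ≡ vs′
  Unique⇒++-∷-injective []       _ []         _ _ eq = refl , ∷-injectiveʳ eq
  Unique⇒++-∷-injective {x} [] _ (_ ∷ us′) _ uq eq with refl , vs≡ ← ∷-injective eq =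
    ⊥-elim (Unique[x∷xs]⇒x∉xs uq (subst (x ∈_) (sym vs≡) (∈-insert us′)))
  Unique⇒++-∷-injective (u ∷ us) _ [] _ uq eq with refl , _ ← ∷-injective eq =
    ⊥-elim (Unique[x∷xs]⇒x∉xs uq (∈-insert us))
  Unique⇒++-∷-injective (u ∷ us) vs (_ ∷ us′) vs′ (_ ∷ uq) eq
    with refl , eq′ ← ∷-injective eq
    with refl , vs≡ ← Unique⇒++-∷-injective us vs us′ vs′ uq eq′ = refl , vs≡

  data CyclicSucc (xs : List A) (x y : A) : Set a where
    adjacent : ∀ us vs → xs ≡ us ++ x ∷ y ∷ vs → CyclicSucc xs x y
    wrap     : ∀ us vs → xs ≡ us ∷ʳ x → xs ≡ y ∷ vs → CyclicSucc xs x y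

  cyclicSucc-∈ˡ : CyclicSucc xs x y → x ∈ xs
  cyclicSucc-∈ˡ (adjacent us _ refl) = ∈-insert us
  cyclicSucc-∈ˡ (wrap us _ refl _)   = ∈-insert us

  cyclicSucc-∈ʳ : CyclicSucc xs x y → y ∈ xs
  cyclicSucc-∈ʳ (adjacent us _ refl) = ∈-++⁺ʳ us (there (here refl))
  cyclicSucc-∈ʳ (wrap _ _ _ refl)    = here refl

  cyclicSucc-functional : Unique xs → CyclicSucc xs x y → CyclicSucc xs x y′ → y ≡ y′
  cyclicSucc-functional uq (adjacent us _ refl) (adjacent us′ _ eq) =
    ∷-injectiveˡ (proj₂ (Unique⇒++-∷-injective us _ us′ _ uq eq))
  cyclicSucc-functional uq (adjacent us _ refl) (wrap us′ _ eq _)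
    with () ← proj₂ (Unique⇒++-∷-injective us _ us′ [] uq eq)
  cyclicSucc-functional uq (wrap us _ refl _) (adjacent us′ _ eq)
    with () ← proj₂ (Unique⇒++-∷-injective us [] us′ _ uq eq)
  cyclicSucc-functional uq (wrap _ _ _ eq) (wrap _ _ _ eq′) = ∷-injectiveˡ (trans (sym eq) eq′)

  cyclicSucc-reverse : CyclicSucc xs x y → CyclicSucc (reverse xs) y x
  cyclicSucc-reverse {x = x} {y} (adjacent us vs refl) =
    adjacent (reverse vs) (reverse us) (reverse-++-∷-∷ us x y vs)
  cyclicSucc-reverse {x = x} {y} (wrap us vs refl eq) =
    wrap (reverse vs) (reverse us) (trans (cong reverse eq) (unfold-reverse y vs)) (reverse-++ us [ x ])

  cyclicSucc-injective : Unique xs → CyclicSucc xs x y → CyclicSucc xs x′ y → x ≡ x′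
  cyclicSucc-injective uq s s′ =
    cyclicSucc-functional (Unique-reverse uq) (cyclicSucc-reverse s) (cyclicSucc-reverse s′)

  cyclicSucc-exists : x ∈ xs → ∃ (CyclicSucc xs x)
  cyclicSucc-exists {xs = z ∷ zs} x∈xs with ∈-∃++ x∈xs
  ... | us , y ∷ vs , eq = y , adjacent us vs eq
  ... | us , []     , eq = z , wrap us zs eq refl

  cyclicPred-exists : y ∈ xs → ∃ λ x → CyclicSucc xs x y
  cyclicPred-exists {y} {xs} y∈xs with x , s ← cyclicSucc-exists (reverse⁺ y∈xs) =
    x , subst (λ zs → CyclicSucc zs x y) (reverse-involutive xs) (cyclicSucc-reverse s)

firstSuch-filterᵇ : ∀ f ps → firstSuch f ps ≡ head (filterᵇ f ps)
firstSuch-filterᵇ f []       = refl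
firstSuch-filterᵇ f (p ∷ ps) with f p
... | true  = refl
... | false = firstSuch-filterᵇ f ps

after-++-∷ : ∀ us {v vs} → v ∉ us → after v (us ++ v ∷ vs) ≡ vs
after-++-∷ [] {v} _ with v ≟P v
... | yes _   = refl
... | no v≢v  = ⊥-elim (v≢v refl)
after-++-∷ (u ∷ us) {v} v∉us with v ≟P u
... | yes refl = ⊥-elim (v∉us (here refl))
... | no _     = after-++-∷ us (v∉us ∘ there)

isEmpty-reverse : ∀ ps → isEmpty (reverse ps) ≡ isEmpty ps
isEmpty-reverse []       = refl
isEmpty-reverse (p ∷ ps) = isEmpty-ʳ++-∷ ps
  where
  isEmpty-ʳ++-∷ : ∀ ps {q qs} → isEmpty (ps ʳ++ q ∷ qs) ≡ false
  isEmpty-ʳ++-∷ []       = refl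
  isEmpty-ʳ++-∷ (p ∷ ps) = isEmpty-ʳ++-∷ ps

Desc : Dir → Path → Set
Desc d p = T (isDesc d p)

desc? : ∀ d p → Dec (Desc d p)
desc? d p = T? (isDesc d p)

Desc⇒lastDir : ∀ {d} p → Desc d p → lastDir p ≡ just d
Desc⇒lastDir {d} p _ with lastDir p
... | just e with d ≟D e
...   | yes refl = refl

Desc-disjoint : ∀ {p} → Desc L p → Desc R p → ⊥
Desc-disjoint {p} l r with () ← trans (sym (Desc⇒lastDir p l)) (Desc⇒lastDir p r)

Desc-∷ : ∀ d q → Desc L (d ∷ q) ⊎ Desc R (d ∷ q)
Desc-∷ L []      = inj₁ tt
Desc-∷ R []      = inj₂ tt
Desc-∷ _ (e ∷ q) = Desc-∷ e q

lefts rights : List Path → List Path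
lefts  = filterᵇ (isDesc L)
rights = filterᵇ (isDesc R)

endpointCycle : List Path → List Path
endpointCycle ps = rights ps ++ reverse (lefts ps)

record EndpointOrder (ps : List Path) : Set where
  field
    unique     : Unique ps
    oriented   : ∀ {p} → p ∈ ps → Desc L p ⊎ Desc R p
    startsLeft : ∃₂ λ p qs → ps ≡ p ∷ qs × Desc L p
    endsRight  : ∃₂ λ qs p → ps ≡ qs ∷ʳ p × Desc R p

endpointCycle-unique : ∀ {ps} → Unique ps → Unique (endpointCycle ps)
endpointCycle-unique {ps} uq =
  ++⁺ (filter⁺ (desc? R) uq) (Unique-reverse (filter⁺ (desc? L) uq)) disjoint
  where
  disjoint : ∀ {p} → ¬ (p ∈ rights ps × p ∈ reverse (lefts ps))
  disjoint {p} (r , l) = Desc-disjoint {p}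
    (proj₂ (∈-filter⁻ (desc? L) {xs = ps} (reverse⁻ {xs = lefts ps} l)))
    (proj₂ (∈-filter⁻ (desc? R) {xs = ps} r))

∈-endpointCycle⁻ : ∀ {p ps} → p ∈ endpointCycle ps → p ∈ ps
∈-endpointCycle⁻ {ps = ps} m with ∈-++⁻ (rights ps) m
... | inj₁ r = proj₁ (∈-filter⁻ _ r)
... | inj₂ l = proj₁ (∈-filter⁻ _ (reverse⁻ l))

∈-endpointCycle⁺ : ∀ {p ps} → EndpointOrder ps → p ∈ ps → p ∈ endpointCycle ps
∈-endpointCycle⁺ {ps = ps} o m with EndpointOrder.oriented o m
... | inj₁ l = ∈-++⁺ʳ (rights ps) (reverse⁺ (∈-filter⁺ (desc? L) m l))
... | inj₂ r = ∈-++⁺ˡ (∈-filter⁺ (desc? R) m r)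

endpointCycle-right : ∀ us {v} vs → Desc R v →
  endpointCycle (us ++ v ∷ vs) ≡ rights us ++ v ∷ rights vs ++ reverse (lefts (us ++ v ∷ vs))
endpointCycle-right us {v} vs r = begin
  rights (us ++ v ∷ vs) ++ ls            ≡⟨ cong (_++ ls) (filter-++ _ us (v ∷ vs)) ⟩
  (rights us ++ rights (v ∷ vs)) ++ ls   ≡⟨ cong (λ zs → (rights us ++ zs) ++ ls) (filter-accept (desc? R) r) ⟩
  (rights us ++ v ∷ rights vs) ++ ls     ≡⟨ ++-assoc (rights us) _ ls ⟩
  rights us ++ v ∷ rights vs ++ ls       ∎
  where ls = reverse (lefts (us ++ v ∷ vs))

endpointCycle-left : ∀ us {v} vs → Desc L v →
  endpointCycle (us ++ v ∷ vs) ≡ (rights (us ++ v ∷ vs) ++ reverse (lefts vs)) ++ v ∷ reverse (lefts us)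
endpointCycle-left us {v} vs l = begin
  rs ++ reverse (lefts (us ++ v ∷ vs))
    ≡⟨ cong (λ zs → rs ++ reverse zs) (filter-++ _ us (v ∷ vs)) ⟩
  rs ++ reverse (lefts us ++ lefts (v ∷ vs))
    ≡⟨ cong (λ zs → rs ++ reverse (lefts us ++ zs)) (filter-accept (desc? L) l) ⟩
  rs ++ reverse (lefts us ++ v ∷ lefts vs)
    ≡⟨ cong (rs ++_) (reverse-++-∷ (lefts us) v (lefts vs)) ⟩
  rs ++ reverse (lefts vs) ++ v ∷ reverse (lefts us)
    ≡⟨ ++-assoc rs _ _ ⟨
  (rs ++ reverse (lefts vs)) ++ v ∷ reverse (lefts us)
    ∎
  where rs = rights (us ++ v ∷ vs)

chooseW-right : ∀ us {v vs} → Desc R v → v ∉ us → chooseW v (us ++ v ∷ vs) ≡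
  (if isEmpty vs then firstSuch (isDesc L) (reverse (us ++ v ∷ vs)) else firstSuch (isDesc R) vs)
chooseW-right us {v} {vs} r v∉us rewrite Desc⇒lastDir v r | after-++-∷ us {v} {vs} v∉us = refl

chooseW-left : ∀ us {v vs} → Desc L v → v ∉ vs → chooseW v (us ++ v ∷ vs) ≡
  (if isEmpty us then firstSuch (isDesc R) (us ++ v ∷ vs) else firstSuch (isDesc L) (reverse us))
chooseW-left us {v} {vs} l v∉vs
  rewrite Desc⇒lastDir v l | reverse-++-∷ us v vs
        | after-++-∷ (reverse vs) {v} {reverse us} (v∉vs ∘ reverse⁻) | isEmpty-reverse us
        = refl

ChoosesSucc : List Path → Path → Path → Set
ChoosesSucc ps v w = chooseW v ps ≡ just w × CyclicSucc (endpointCycle ps) v w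

chooseW-right-cyclicSucc : ∀ us {v} vs → EndpointOrder (us ++ v ∷ vs) → v ∉ us → Desc R v →
  ∃ (ChoosesSucc (us ++ v ∷ vs) v)
chooseW-right-cyclicSucc us {v} [] o v∉us r
  with p , _ , eq , l ← EndpointOrder.startsLeft o
  with w , ws , lefts≡ ← ∈⇒∷ (reverse⁺ (∈-filter⁺ (desc? L) (subst (p ∈_) (sym eq) (here refl)) l))
  = w , chosen ,
    adjacent (rights us) ws (trans (endpointCycle-right us [] r) (cong (λ zs → rights us ++ v ∷ zs) lefts≡))
  where
  ps = us ++ v ∷ []
  chosen : chooseW v ps ≡ just w
  chosen = begin
    chooseW v ps                       ≡⟨ chooseW-right us r v∉us ⟩
    firstSuch (isDesc L) (reverse ps)  ≡⟨ firstSuch-filterᵇ _ (reverse ps) ⟩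
    head (lefts (reverse ps))          ≡⟨ cong head (trans (filterᵇ-reverse _ ps) lefts≡) ⟩
    just w                             ∎
chooseW-right-cyclicSucc us {v} (y ∷ ys) o v∉us r
  with _ , z , eq , rz ← EndpointOrder.endsRight o
  with w , ws , rights≡ ← ∈⇒∷ (∈-filter⁺ (desc? R) (last-∈-suffix (us ++ [ v ]) (trans (++-assoc us _ _) eq)) rz)
  = w , chosen , adjacent (rights us) (ws ++ ls)
      (trans (endpointCycle-right us (y ∷ ys) r) (cong (λ zs → rights us ++ v ∷ zs ++ ls) rights≡))
  where
  ls = reverse (lefts (us ++ v ∷ y ∷ ys))
  chosen : chooseW v (us ++ v ∷ y ∷ ys) ≡ just w
  chosen = begin
    chooseW v (us ++ v ∷ y ∷ ys)   ≡⟨ chooseW-right us r v∉us ⟩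
    firstSuch (isDesc R) (y ∷ ys)  ≡⟨ firstSuch-filterᵇ _ (y ∷ ys) ⟩
    head (rights (y ∷ ys))         ≡⟨ cong head rights≡ ⟩
    just w                         ∎

chooseW-left-cyclicSucc : ∀ us {v} vs → EndpointOrder (us ++ v ∷ vs) → v ∉ vs → Desc L v →
  ∃ (ChoosesSucc (us ++ v ∷ vs) v)
chooseW-left-cyclicSucc [] {v} vs o v∉vs l
  with qs , z , eq , rz ← EndpointOrder.endsRight o
  with w , ws , rights≡ ← ∈⇒∷ (∈-filter⁺ (desc? R) (subst (z ∈_) (sym eq) (∈-insert qs)) rz)
  = w , chosen ,
    wrap (rights (v ∷ vs) ++ reverse (lefts vs)) (ws ++ ls) (endpointCycle-left [] vs l) (cong (_++ ls) rights≡)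
  where
  ls = reverse (lefts (v ∷ vs))
  chosen : chooseW v (v ∷ vs) ≡ just w
  chosen = begin
    chooseW v (v ∷ vs)             ≡⟨ chooseW-left [] l v∉vs ⟩
    firstSuch (isDesc R) (v ∷ vs)  ≡⟨ firstSuch-filterᵇ _ (v ∷ vs) ⟩
    head (rights (v ∷ vs))         ≡⟨ cong head rights≡ ⟩
    just w                         ∎
chooseW-left-cyclicSucc (q ∷ qs) {v} vs o v∉vs l
  with _ , _ , eq , lq ← EndpointOrder.startsLeft o
  with refl , _ ← ∷-injective eq
  with w , ws , lefts≡ ← ∈⇒∷ (reverse⁺ (∈-filter⁺ (desc? L) (here {x = q} {xs = qs} refl) lq))
  = w , chosen ,
    adjacent before ws (trans (endpointCycle-left (q ∷ qs) vs l) (cong (λ zs → before ++ v ∷ zs) lefts≡))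
  where
  before = rights (q ∷ qs ++ v ∷ vs) ++ reverse (lefts vs)
  chosen : chooseW v (q ∷ qs ++ v ∷ vs) ≡ just w
  chosen = begin
    chooseW v (q ∷ qs ++ v ∷ vs)             ≡⟨ chooseW-left (q ∷ qs) l v∉vs ⟩
    firstSuch (isDesc L) (reverse (q ∷ qs))  ≡⟨ firstSuch-filterᵇ _ (reverse (q ∷ qs)) ⟩
    head (lefts (reverse (q ∷ qs)))          ≡⟨ cong head (trans (filterᵇ-reverse _ (q ∷ qs)) lefts≡) ⟩
    just w                                   ∎

chooseW-cyclicSucc : ∀ {ps v} → EndpointOrder ps → v ∈ ps → ∃ (ChoosesSucc ps v)
chooseW-cyclicSucc o v∈ps with us , vs , refl ← ∈-∃++ v∈ps with EndpointOrder.oriented o v∈ps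
... | inj₁ l = chooseW-left-cyclicSucc us vs o (Unique-++-∷⇒∉ʳ us (EndpointOrder.unique o)) l
... | inj₂ r = chooseW-right-cyclicSucc us vs o (Unique-++-∷⇒∉ˡ us (EndpointOrder.unique o)) r

cherry : Tree
cherry = node leaf leaf

size : Tree → ℕ
size t = length (leaves t)

size-node : ∀ l r → size (node l r) ≡ size l + size r
size-node l r = trans (length-++ (map (L ∷_) (leaves l)))
                      (cong₂ _+_ (length-map (L ∷_) (leaves l)) (length-map (R ∷_) (leaves r)))

replace-replace : ∀ t p a b → replace (replace t p a) p b ≡ replace t p b
replace-replace t          []      a b = refl
replace-replace leaf       (_ ∷ _) a b = refl
replace-replace (node l r) (L ∷ p) a b = cong (λ l′ → node l′ r) (replace-replace l p a b)
replace-replace (node l r) (R ∷ p) a b = cong (node l) (replace-replace r p a b)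

replace-subtree : ∀ t p {s} → subtree t p ≡ just s → replace t p s ≡ t
replace-subtree t          []      refl = refl
replace-subtree (node l r) (L ∷ p) eq   = cong (λ l′ → node l′ r) (replace-subtree l p eq)
replace-subtree (node l r) (R ∷ p) eq   = cong (node l) (replace-subtree r p eq)

subtree-replace : ∀ t p {s} s′ → subtree t p ≡ just s → subtree (replace t p s′) p ≡ just s′
subtree-replace t          []      s′ _  = refl
subtree-replace (node l r) (L ∷ p) s′ eq = subtree-replace l p s′ eq
subtree-replace (node l r) (R ∷ p) s′ eq = subtree-replace r p s′ eq

replace-undo : ∀ t p {s} s′ → subtree t p ≡ just s → replace (replace t p s′) p s ≡ t
replace-undo t p {s} s′ eq = trans (replace-replace t p s′ s) (replace-subtree t p eq)

replace-marked-injective : ∀ {t t′ p p′ s} s′ → subtree t p ≡ just s → subtree t′ p′ ≡ just s →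
  (replace t p s′ , p) ≡ (replace t′ p′ s′ , p′) → (t , p) ≡ (t′ , p′)
replace-marked-injective {t} {t′} {p} {s = s} s′ eq eq′ e with refl ← cong proj₂ e = cong (_, p) (begin
  t                          ≡⟨ replace-undo t p s′ eq ⟨
  replace (replace t p s′) p s  ≡⟨ cong (λ u → replace u p s) (cong proj₁ e) ⟩
  replace (replace t′ p s′) p s ≡⟨ replace-undo t′ p s′ eq′ ⟩
  t′                         ∎)

size-replace : ∀ t p {s} s′ → subtree t p ≡ just s → size (replace t p s′) + size s ≡ size t + size s′
size-replace t [] s′ refl = +-comm (size s′) (size t)
size-replace (node l r) (L ∷ p) {s} s′ eq = begin
  size (node (replace l p s′) r) + size s  ≡⟨ cong (_+ size s) (size-node (replace l p s′) r) ⟩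
  size (replace l p s′) + size r + size s  ≡⟨ xy∙z≈xz∙y (size (replace l p s′)) (size r) (size s) ⟩
  size (replace l p s′) + size s + size r  ≡⟨ cong (_+ size r) (size-replace l p s′ eq) ⟩
  size l + size s′ + size r                ≡⟨ xy∙z≈xz∙y (size l) (size s′) (size r) ⟩
  size l + size r + size s′                ≡⟨ cong (_+ size s′) (size-node l r) ⟨
  size (node l r) + size s′                ∎
size-replace (node l r) (R ∷ p) {s} s′ eq = begin
  size (node l (replace r p s′)) + size s    ≡⟨ cong (_+ size s) (size-node l (replace r p s′)) ⟩
  size l + size (replace r p s′) + size s    ≡⟨ +-assoc (size l) _ (size s) ⟩
  size l + (size (replace r p s′) + size s)  ≡⟨ cong (size l +_) (size-replace r p s′ eq) ⟩
  size l + (size r + size s′)                ≡⟨ +-assoc (size l) (size r) (size s′) ⟨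
  size l + size r + size s′                  ≡⟨ cong (_+ size s′) (size-node l r) ⟨
  size (node l r) + size s′                  ∎

∈-leaves⇒subtree : ∀ t {p} → p ∈ leaves t → subtree t p ≡ just leaf
∈-leaves⇒subtree leaf       (here refl) = refl
∈-leaves⇒subtree (node l r) m with ∈-++⁻ (map (L ∷_) (leaves l)) m
... | inj₁ ml with q , mq , refl ← ∈-map⁻ (L ∷_) ml = ∈-leaves⇒subtree l mq
... | inj₂ mr with q , mq , refl ← ∈-map⁻ (R ∷_) mr = ∈-leaves⇒subtree r mq

subtree⇒∈-leaves : ∀ t p → subtree t p ≡ just leaf → p ∈ leaves t
subtree⇒∈-leaves leaf       []      _  = here refl
subtree⇒∈-leaves (node l r) (L ∷ p) eq = ∈-++⁺ˡ (∈-map⁺ (L ∷_) (subtree⇒∈-leaves l p eq))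
subtree⇒∈-leaves (node l r) (R ∷ p) eq = ∈-++⁺ʳ _ (∈-map⁺ (R ∷_) (subtree⇒∈-leaves r p eq))

leaves-unique : ∀ t → Unique (leaves t)
leaves-unique leaf       = [] ∷ []
leaves-unique (node l r) =
  ++⁺ (map⁺ ∷-injectiveʳ (leaves-unique l)) (map⁺ ∷-injectiveʳ (leaves-unique r)) disjoint
  where
  disjoint : ∀ {p} → ¬ (p ∈ map (L ∷_) (leaves l) × p ∈ map (R ∷_) (leaves r))
  disjoint (ml , mr) with _ , _ , refl ← ∈-map⁻ (L ∷_) ml with _ , _ , () ← ∈-map⁻ (R ∷_) mr

leftmostLeaf rightmostLeaf : Tree → Path
leftmostLeaf leaf        = []
leftmostLeaf (node l _)  = L ∷ leftmostLeaf l
rightmostLeaf leaf       = []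
rightmostLeaf (node _ r) = R ∷ rightmostLeaf r

leftmostLeaf-Desc : ∀ t → Desc L (L ∷ leftmostLeaf t)
leftmostLeaf-Desc leaf       = tt
leftmostLeaf-Desc (node l _) = leftmostLeaf-Desc l

rightmostLeaf-Desc : ∀ t → Desc R (R ∷ rightmostLeaf t)
rightmostLeaf-Desc leaf       = tt
rightmostLeaf-Desc (node _ r) = rightmostLeaf-Desc r

leaves-leftmost : ∀ t → ∃ λ qs → leaves t ≡ leftmostLeaf t ∷ qs
leaves-leftmost leaf = [] , refl
leaves-leftmost (node l r) with qs , eq ← leaves-leftmost l =
  _ , cong (λ ps → map (L ∷_) ps ++ map (R ∷_) (leaves r)) eq

leaves-rightmost : ∀ t → ∃ λ qs → leaves t ≡ qs ∷ʳ rightmostLeaf t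
leaves-rightmost leaf = [] , refl
leaves-rightmost (node l r) with qs , eq ← leaves-rightmost r = ls ++ map (R ∷_) qs , (begin
  ls ++ map (R ∷_) (leaves r)                     ≡⟨ cong (λ ps → ls ++ map (R ∷_) ps) eq ⟩
  ls ++ map (R ∷_) (qs ∷ʳ rightmostLeaf r)        ≡⟨ cong (ls ++_) (map-++ (R ∷_) qs [ rightmostLeaf r ]) ⟩
  ls ++ map (R ∷_) qs ∷ʳ (R ∷ rightmostLeaf r)    ≡⟨ ++-assoc ls _ _ ⟨
  (ls ++ map (R ∷_) qs) ∷ʳ (R ∷ rightmostLeaf r)  ∎)
  where ls = map (L ∷_) (leaves l)

endpointOrder : ∀ l r → EndpointOrder (leaves (node l r))
endpointOrder l r = record
  { unique     = leaves-unique (node l r)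
  ; oriented   = oriented
  ; startsLeft = _ , _ , proj₂ (leaves-leftmost (node l r)) , leftmostLeaf-Desc l
  ; endsRight  = _ , _ , proj₂ (leaves-rightmost (node l r)) , rightmostLeaf-Desc r
  }
  where
  oriented : ∀ {p} → p ∈ leaves (node l r) → Desc L p ⊎ Desc R p
  oriented m with ∈-++⁻ (map (L ∷_) (leaves l)) m
  ... | inj₁ ml with q , _ , refl ← ∈-map⁻ (L ∷_) ml = Desc-∷ L q
  ... | inj₂ mr with q , _ , refl ← ∈-map⁻ (R ∷_) mr = Desc-∷ R q

endpointOrder-of-size : ∀ {n} c → 1 ≤ n → size c ≡ suc n → EndpointOrder (leaves c)
endpointOrder-of-size leaf       () refl
endpointOrder-of-size (node l r) _  _ = endpointOrder l r

contract expand : Tree → Path → Tree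
contract t v = replace t v leaf
expand c w   = replace c w cherry

contract-size : ∀ {n} t v → ValidMarked n (t , v) → size (contract t v) ≡ suc n
contract-size {n} t v (size≡ , lbv) =
  +-cancelʳ-≡ 2 _ _ (trans (size-replace t v leaf lbv) (trans (cong (_+ 1) size≡) (+-comm (n + 2) 1)))

∈-leaves-contract : ∀ t v → IsLBV t v → v ∈ leaves (contract t v)
∈-leaves-contract t v lbv = subtree⇒∈-leaves (contract t v) v (subtree-replace t v leaf lbv)

expand-valid : ∀ {n} c w → size c ≡ suc n → subtree c w ≡ just leaf → ValidMarked n (expand c w , w)
expand-valid {n} c w size≡ leaf≡ =
  +-cancelʳ-≡ 1 _ _ (trans (size-replace c w cherry leaf≡) (trans (cong (_+ 2) size≡) (sym (+-comm (n + 2) 1)))) ,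
  subtree-replace c w cherry leaf≡

endpointCycle-leaf : ∀ c {w} → w ∈ endpointCycle (leaves c) → subtree c w ≡ just leaf
endpointCycle-leaf c = ∈-leaves⇒subtree c ∘ ∈-endpointCycle⁻

π-unfold : ∀ {t v c w} → contract t v ≡ c → chooseW v (leaves c) ≡ just w → π (t , v) ≡ (expand c w , w)
π-unfold refl chosen rewrite chosen = refl

module _ {n} (1≤n : 1 ≤ n) where

  contraction-order : ∀ t v → ValidMarked n (t , v) → EndpointOrder (leaves (contract t v))
  contraction-order t v valid = endpointOrder-of-size (contract t v) 1≤n (contract-size t v valid)

  π-cyclicSucc : ∀ t v → ValidMarked n (t , v) →
    ∃ λ w → CyclicSucc (endpointCycle (leaves (contract t v))) v w × π (t , v) ≡ (expand (contract t v) w , w)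
  π-cyclicSucc t v valid@(_ , lbv)
    with w , chosen , succ ← chooseW-cyclicSucc (contraction-order t v valid) (∈-leaves-contract t v lbv)
    = w , succ , π-unfold refl chosen

  π-valid : ∀ x → ValidMarked n x → ValidMarked n (π x)
  π-valid (t , v) valid with w , succ , π≡ ← π-cyclicSucc t v valid =
    subst (ValidMarked n) (sym π≡)
      (expand-valid (contract t v) w (contract-size t v valid) (endpointCycle-leaf (contract t v) (cyclicSucc-∈ʳ succ)))

  π-injective : ∀ x y → ValidMarked n x → ValidMarked n y → π x ≡ π y → x ≡ y
  π-injective (t , v) (t′ , v′) valid@(_ , lbv) valid′@(_ , lbv′) π≡π′
    with w , succ , π≡ ← π-cyclicSucc t v valid
    with w′ , succ′ , π≡′ ← π-cyclicSucc t′ v′ valid′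
    with cw≡c′w′ ← replace-marked-injective cherry
                     (endpointCycle-leaf (contract t v) (cyclicSucc-∈ʳ succ))
                     (endpointCycle-leaf (contract t′ v′) (cyclicSucc-∈ʳ succ′))
                     (trans (sym π≡) (trans π≡π′ π≡′))
    with refl ← cong proj₂ cw≡c′w′
    = replace-marked-injective leaf lbv lbv′ (cong₂ _,_ c≡c′ v≡v′)
    where
    c≡c′ : contract t v ≡ contract t′ v′
    c≡c′ = cong proj₁ cw≡c′w′
    v≡v′ : v ≡ v′
    v≡v′ = cyclicSucc-injective (endpointCycle-unique (leaves-unique (contract t v))) succ
             (subst (λ c → CyclicSucc (endpointCycle (leaves c)) v′ w) (sym c≡c′) succ′)

  π-surjective : ∀ y → ValidMarked n y → Σ Marked λ x → ValidMarked n x × π x ≡ y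
  π-surjective (t , w) valid@(_ , lbv)
    with v , succ ← cyclicPred-exists (∈-endpointCycle⁺ (contraction-order t w valid) (∈-leaves-contract t w lbv))
    with w′ , chosen , succ′ ← chooseW-cyclicSucc (contraction-order t w valid) (∈-endpointCycle⁻ (cyclicSucc-∈ˡ succ))
    with refl ← cyclicSucc-functional (endpointCycle-unique (leaves-unique (contract t w))) succ′ succ
    = (expand (contract t w) v , v) , expand-valid (contract t w) v (contract-size t w valid) v-leaf ,
      trans (π-unfold (replace-undo (contract t w) v cherry v-leaf) chosen) (cong (_, w) (replace-undo t w leaf lbv))
    where
    v-leaf : subtree (contract t w) v ≡ just leaf
    v-leaf = endpointCycle-leaf (contract t w) (cyclicSucc-∈ˡ succ)

lemma2 : (n : ℕ) → 1 ≤ n →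
    ((x : Marked) → ValidMarked n x → ValidMarked n (π x))
    × ((x y : Marked) → ValidMarked n x → ValidMarked n y → π x ≡ π y → x ≡ y)
    × ((y : Marked) → ValidMarked n y → Σ Marked (λ x → ValidMarked n x × π x ≡ y))
lemma2 n 1≤n = π-valid 1≤n , π-injective 1≤n , π-surjective 1≤n
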